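{- For every integer $n\ge 6$ there exist a set $P$ of $n$ points in general position in the plane and a family $\mathcal{S}$ of subsets of $P$ such that $C(\mathcal{S})$ is a convex hull thrackle on $P$ consisting of $n+1$ convex hulls.
   Context: Points are in general position if no three are collinear. Given a set $P$ of $n$ points in general position in the plane and a family $\mathcal{S}$ of subsets of $P$ whose convex hulls are pairwise different, let $C(\mathcal{S})=\{\mathrm{Conv}(S):S\in\mathcal{S}\}$, where $\mathrm{Conv}(S)$ is the convex hull of $S$. $C(\mathcal{S})$ is a convex hull thrackle on $P$ if: (1) $C_1\not\subset C_2$ for any two different $C_1,C_2\in C(\mathcal{S})$; (2) $C_1\cap C_2\neq\emptyset$ for any two different $C_1,C_2\in C(\mathcal{S})$; (3) $C_1\cap C_2\cap C_3\subset P$ for any three different $C_1,C_2,C_3\in C(\mathcal{S})$. The number of convex hulls is $|C(\mathcal{S})|=|\mathcal{S}|$.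
   Formalization: The points of P have rational coordinates, and membership in the convex hulls, for their pairwise difference and for conditions (1)–(3), is tested only at points with rational coordinates. -}

module Defs where

open import Data.Nat using (ℕ; zero; suc)
open import Data.Fin using (Fin; zero; suc)
open import Data.Fin.Subset using (Subset; _∈_; _∉_)
open import Data.Rational using (ℚ; 0ℚ; 1ℚ; _+_; _*_; _-_; _≤_)
open import Data.Product using (_×_; _,_; proj₁; proj₂; Σ; ∃)
open import Relation.Binary.PropositionalEquality using (_≡_; _≢_)
open import Relation.Nullary using (¬_)

Point : Set
Point = ℚ × ℚ

sumℚ : ∀ {n} → (Fin n → ℚ) → ℚ
sumℚ {zero}  f = 0ℚ
sumℚ {suc n} f = f zero + sumℚ (λ i → f (suc i))

-- Orientation determinant of (a, b, c); zero iff collinear.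
orient : Point → Point → Point → ℚ
orient (ax , ay) (bx , by) (cx , cy) =
  ((bx - ax) * (cy - ay)) - ((by - ay) * (cx - ax))

GeneralPosition : ∀ {n} → (Fin n → Point) → Set
GeneralPosition {n} p =
  (∀ (i j : Fin n) → i ≢ j → p i ≢ p j) ×
  (∀ (i j k : Fin n) → i ≢ j → j ≢ k → i ≢ k → orient (p i) (p j) (p k) ≢ 0ℚ)

InConv : ∀ {n} → (Fin n → Point) → Subset n → Point → Set
InConv {n} p S q =
  Σ (Fin n → ℚ) λ w →
    (∀ i → 0ℚ ≤ w i) ×
    (∀ i → i ∉ S → w i ≡ 0ℚ) ×
    (sumℚ w ≡ 1ℚ) ×
    (sumℚ (λ i → w i * proj₁ (p i)) ≡ proj₁ q) ×
    (sumℚ (λ i → w i * proj₂ (p i)) ≡ proj₂ q)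

ConvSub : ∀ {n} → (Fin n → Point) → Subset n → Subset n → Set
ConvSub p S T = ∀ q → InConv p S q → InConv p T q

ConvEq : ∀ {n} → (Fin n → Point) → Subset n → Subset n → Set
ConvEq p S T = ConvSub p S T × ConvSub p T S

IsConvexHullThrackle : ∀ {n m} → (Fin n → Point) → (Fin m → Subset n) → Set
IsConvexHullThrackle {n} {m} p S =
  (∀ (a b : Fin m) → a ≢ b → ¬ ConvEq p (S a) (S b)) ×
  (∀ (a b : Fin m) → a ≢ b → ¬ ConvSub p (S a) (S b)) ×
  (∀ (a b : Fin m) → a ≢ b → ∃ λ q → InConv p (S a) q × InConv p (S b) q) ×
  (∀ (a b c : Fin m) → a ≢ b → b ≢ c → a ≢ c → ∀ q →
     InConv p (S a) q → InConv p (S b) q → InConv p (S c) q →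
     ∃ λ (i : Fin n) → p i ≡ q)

-- Take five corners U V R A B and m ≥ 1 points L j on the arc of the parabola y = x² over (0, 1], and the
-- 6 + m hulls UVR, UAB, VAB, URB, RBL, RAL and UL j (L standing for all parabola points, UL j a segment).
-- Most pairs of hulls touch: they meet in a single common vertex, certified by a line through it with one
-- hull weakly on one side and the other hull, apart from that vertex, strictly on the other.  For two
-- segments UL j, UL k this is a line through U; for UL j against RBL or RAL it is the tangent at L j.
-- The six remaining pairs all run between {VAB, URB, RAL} and the other hulls, so among any three hulls two
-- touch and every triple intersection is a point of P.  Touching hulls are not nested because each has a
-- second vertex, the other pairs are separated by explicit lines, and general position reduces to sign
-- estimates for the orientation determinant along the arc.

{-# OPTIONS --safe #-}
module Submission where

open import Defs
open import Agda.Builtin.FromNat using (Number; fromNat)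
open import Agda.Builtin.FromNeg using (fromNeg)
import Agda.Builtin.FromNeg as FromNeg
open import Algebra.Properties.Group using (inverseˡ-unique; ⁻¹-involutive)
open import Data.Bool using (Bool; true; false; if_then_else_)
open import Data.Empty using (⊥-elim)
open import Data.Fin using (Fin; zero; suc; toℕ; splitAt)
import Data.Fin.Properties as Fin
open import Data.Fin.Subset using (Subset; _∈_; _∉_; ⁅_⁆; _∪_; ⊥)
open import Data.Fin.Subset.Properties using (_∈?_; x∈⁅x⁆; x∈⁅y⁆⇒x≡y; x∈p∪q⁻; x∈p∪q⁺; ∉⊥)
open import Data.Integer using (ℤ)
import Data.Integer as ℤ
import Data.Integer.Literals as ℤ-Literals
open import Data.List using (List; []; _∷_; foldr)
import Data.List as List
open import Data.List.Membership.Propositional using () renaming (_∈_ to _∈ₗ_)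
open import Data.List.Membership.Propositional.Properties using (∈-tabulate⁺)
open import Data.List.Relation.Unary.All using (All; []; _∷_)
import Data.List.Relation.Unary.All as All
open import Data.List.Relation.Unary.All.Properties using (tabulate⁺)
open import Data.List.Relation.Unary.Any using (here; there)
open import Data.Nat using (ℕ; zero; suc; s≤s; z≤n)
import Data.Nat as ℕ
open import Data.Nat.Coprimality using (1-coprimeTo)
import Data.Nat.Literals as ℕ-Literals
open import Data.Product using (_×_; _,_; proj₁; proj₂; Σ; ∃; ∃₂)
open import Data.Rational
open import Data.Rational.Properties
import Data.Rational.Literals as ℚ-Literals
open import Data.Sum using (_⊎_; inj₁; inj₂; [_,_]′)
open import Data.Unit using (tt)
open import Function using (_∘_; Injection)
open import Function.Properties.Inverse using (↔⇒↣)
open import Level using (0ℓ)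
open import Relation.Binary using (tri<; tri≈; tri>)
open import Relation.Binary.PropositionalEquality
open import Relation.Nullary using (¬_; yes; no; does)
open import Relation.Nullary.Decidable using (Dec; True; toWitness; from-yes; dec⇒maybe; ¬?; _→-dec_; _×-dec_; _⊎-dec_)
open import Tactic.RingSolver using (solve-∀)
open import Tactic.RingSolver.Core.AlmostCommutativeRing using (AlmostCommutativeRing; fromCommutativeRing)

instance
  ℕ-number : Number ℕ
  ℕ-number = ℕ-Literals.number
  ℤ-number : Number ℤ
  ℤ-number = ℤ-Literals.number
  ℤ-negative : FromNeg.Negative ℤ
  ℤ-negative = ℤ-Literals.negative
  ℚ-number : Number ℚ
  ℚ-number = ℚ-Literals.number
  ℚ-negative : FromNeg.Negative ℚ
  ℚ-negative = ℚ-Literals.negative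

ℚ-ring : AlmostCommutativeRing 0ℓ 0ℓ
ℚ-ring = fromCommutativeRing +-*-commutativeRing (λ x → dec⇒maybe (0ℚ ≟ x))

<-by-eval : ∀ {x y} {_ : True (x <? y)} → x < y
<-by-eval {_} {_} {x<y} = toWitness x<y

≤-by-eval : ∀ {x y} {_ : True (x ≤? y)} → x ≤ y
≤-by-eval {_} {_} {x≤y} = toWitness x≤y

*-nonNeg : ∀ {a b} → 0ℚ ≤ a → 0ℚ ≤ b → 0ℚ ≤ a * b
*-nonNeg {a} {b} 0≤a 0≤b = nonNegative⁻¹ _ {{nonNeg*nonNeg⇒nonNeg a {{nonNegative 0≤a}} b {{nonNegative 0≤b}}}}

*-pos : ∀ {a b} → 0ℚ < a → 0ℚ < b → 0ℚ < a * b
*-pos {a} {b} 0<a 0<b = positive⁻¹ _ {{pos*pos⇒pos a {{positive 0<a}} b {{positive 0<b}}}}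

square-pos : ∀ {a} → a ≢ 0ℚ → 0ℚ < a * a
square-pos {a} a≢0 with <-cmp a 0ℚ
... | tri< a<0 _ _ = positive⁻¹ _ {{neg*neg⇒pos a {{negative a<0}} a {{negative a<0}}}}
... | tri≈ _ a≡0 _ = ⊥-elim (a≢0 a≡0)
... | tri> _ _ a>0 = *-pos a>0 a>0

p*q≢0 : ∀ {p q} → p ≢ 0ℚ → q ≢ 0ℚ → p * q ≢ 0ℚ
p*q≢0 {p} {q} p≢0 q≢0 pq≡0 = <⇒≢ (*-pos (square-pos p≢0) (square-pos q≢0)) (sym (begin
  p * p * (q * q)   ≡⟨ interchange p q ⟩
  (p * q) * (p * q) ≡⟨ cong (λ x → x * x) pq≡0 ⟩
  0ℚ                ∎))
  where
  open ≡-Reasoning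
  interchange : ∀ p q → p * p * (q * q) ≡ (p * q) * (p * q)
  interchange = solve-∀ ℚ-ring

p<p+q : ∀ {p q} → 0ℚ < q → p < p + q
p<p+q {p} {q} 0<q = subst (_< p + q) (+-identityʳ p) (+-monoʳ-< p 0<q)

p≤p+q : ∀ {p q} → 0ℚ ≤ q → p ≤ p + q
p≤p+q {p} {q} 0≤q = subst (_≤ p + q) (+-identityʳ p) (+-monoʳ-≤ p 0≤q)

p≢q⇒p-q≢0 : ∀ {p q} → p ≢ q → p - q ≢ 0ℚ
p≢q⇒p-q≢0 {p} {q} p≢q p-q≡0 = p≢q (trans (inverseˡ-unique +-0-group p (- q) p-q≡0) (⁻¹-involutive +-0-group q))

p<q⇒0<q-p : ∀ {p q} → p < q → 0ℚ < q - p
p<q⇒0<q-p {p} {q} p<q = subst (_< q - p) (+-inverseʳ p) (+-monoˡ-< (- p) p<q)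

p*q≡0⇒p≡0 : ∀ {p q} → p * q ≡ 0ℚ → q ≢ 0ℚ → p ≡ 0ℚ
p*q≡0⇒p≡0 {p} pq≡0 q≢0 with p ≟ 0ℚ
... | yes p≡0 = p≡0
... | no  p≢0 = ⊥-elim (p*q≢0 p≢0 q≢0 pq≡0)

sumℚ-cong : ∀ {n} {f g : Fin n → ℚ} → (∀ i → f i ≡ g i) → sumℚ f ≡ sumℚ g
sumℚ-cong {zero}  f≗g = refl
sumℚ-cong {suc n} f≗g = cong₂ _+_ (f≗g zero) (sumℚ-cong (f≗g ∘ suc))

sumℚ-+ : ∀ {n} (f g : Fin n → ℚ) → sumℚ (λ i → f i + g i) ≡ sumℚ f + sumℚ g
sumℚ-+ {zero}  f g = refl
sumℚ-+ {suc n} f g = trans (cong ((f zero + g zero) +_) (sumℚ-+ (f ∘ suc) (g ∘ suc)))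
                           (+-interchange (f zero) (g zero) _ _)
  where
  +-interchange : ∀ a b c d → (a + b) + (c + d) ≡ (a + c) + (b + d)
  +-interchange = solve-∀ ℚ-ring

sumℚ-*ˡ : ∀ {n} c (f : Fin n → ℚ) → sumℚ (λ i → c * f i) ≡ c * sumℚ f
sumℚ-*ˡ {zero}  c f = sym (*-zeroʳ c)
sumℚ-*ˡ {suc n} c f = trans (cong (c * f zero +_) (sumℚ-*ˡ c (f ∘ suc)))
                            (sym (*-distribˡ-+ c (f zero) _))

sumℚ-mono-≤ : ∀ {n} {f g : Fin n → ℚ} → (∀ i → f i ≤ g i) → sumℚ f ≤ sumℚ g
sumℚ-mono-≤ {zero}  f≤g = ≤-refl
sumℚ-mono-≤ {suc n} f≤g = +-mono-≤ (f≤g zero) (sumℚ-mono-≤ (f≤g ∘ suc))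

sumℚ-zero : ∀ {n} {f : Fin n → ℚ} → (∀ i → f i ≡ 0ℚ) → sumℚ f ≡ 0ℚ
sumℚ-zero {zero}  f≡0 = refl
sumℚ-zero {suc n} f≡0 = cong₂ _+_ (f≡0 zero) (sumℚ-zero (f≡0 ∘ suc))

sumℚ-nonNeg : ∀ {n} {f : Fin n → ℚ} → (∀ i → 0ℚ ≤ f i) → 0ℚ ≤ sumℚ f
sumℚ-nonNeg {n} {f} f≥0 = subst (_≤ sumℚ f) (sumℚ-zero {n} {λ _ → 0ℚ} (λ _ → refl)) (sumℚ-mono-≤ f≥0)

nonNeg-sumℚ≤0⇒zero : ∀ {n} {f : Fin n → ℚ} → (∀ i → 0ℚ ≤ f i) → sumℚ f ≤ 0ℚ → ∀ i → f i ≡ 0ℚ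
nonNeg-sumℚ≤0⇒zero {suc n} {f} f≥0 Σ≤0 zero =
  ≤-antisym (≤-trans (p≤p+q (sumℚ-nonNeg (f≥0 ∘ suc))) Σ≤0) (f≥0 zero)
nonNeg-sumℚ≤0⇒zero {suc n} {f} f≥0 Σ≤0 (suc i) =
  nonNeg-sumℚ≤0⇒zero (f≥0 ∘ suc) (≤-trans (subst (sumℚ (f ∘ suc) ≤_) (+-comm _ (f zero)) (p≤p+q (f≥0 zero))) Σ≤0) i

sumℚ-supported : ∀ {n} {f : Fin n → ℚ} k → (∀ i → i ≢ k → f i ≡ 0ℚ) → sumℚ f ≡ f k
sumℚ-supported {suc n} {f} zero    off-k =
  trans (cong (f zero +_) (sumℚ-zero {f = f ∘ suc} (λ i → off-k (suc i) λ ()))) (+-identityʳ (f zero))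
sumℚ-supported {suc n} {f} (suc k) off-k =
  trans (cong (_+ sumℚ (f ∘ suc)) (off-k zero λ ()))
        (trans (+-identityˡ _) (sumℚ-supported k (λ i i≢k → off-k (suc i) (i≢k ∘ Fin.suc-injective))))

δ : ∀ {n} → Fin n → Fin n → ℚ
δ i k = if does (i Fin.≟ k) then 1ℚ else 0ℚ

δ-diag : ∀ {n} (k : Fin n) → δ k k ≡ 1ℚ
δ-diag k with k Fin.≟ k
... | yes _   = refl
... | no  k≢k = ⊥-elim (k≢k refl)

δ-off : ∀ {n} {i k : Fin n} → i ≢ k → δ i k ≡ 0ℚ
δ-off {i = i} {k} i≢k with i Fin.≟ k
... | yes i≡k = ⊥-elim (i≢k i≡k)
... | no  _   = refl

δ-nonNeg : ∀ {n} (i k : Fin n) → 0ℚ ≤ δ i k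
δ-nonNeg i k with does (i Fin.≟ k)
... | true  = ≤-by-eval
... | false = ≤-refl

sumℚ-δ : ∀ {n} k (f : Fin n → ℚ) → sumℚ (λ i → δ i k * f i) ≡ f k
sumℚ-δ k f = trans (sumℚ-supported k (λ i i≢k → trans (cong (_* f i) (δ-off i≢k)) (*-zeroˡ (f i))))
                   (trans (cong (_* f k) (δ-diag k)) (*-identityˡ (f k)))

-- ws lists weighted vertices (a , k); combine ws (δ i) is the total weight it puts on i.
combine : ∀ {n} → List (ℚ × Fin n) → (Fin n → ℚ) → ℚ
combine []             f = 0ℚ
combine ((a , k) ∷ ws) f = a * f k + combine ws f

sumℚ-combine : ∀ {n} ws (f : Fin n → ℚ) → sumℚ (λ i → combine ws (δ i) * f i) ≡ combine ws f
sumℚ-combine []             f = sumℚ-zero (λ i → *-zeroˡ (f i))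
sumℚ-combine ((a , k) ∷ ws) f = begin
  sumℚ (λ i → (a * δ i k + combine ws (δ i)) * f i)
    ≡⟨ sumℚ-cong (λ i → *-distribʳ-+ (f i) (a * δ i k) _) ⟩
  sumℚ (λ i → a * δ i k * f i + combine ws (δ i) * f i)
    ≡⟨ sumℚ-+ (λ i → a * δ i k * f i) _ ⟩
  sumℚ (λ i → a * δ i k * f i) + sumℚ (λ i → combine ws (δ i) * f i)
    ≡⟨ cong₂ _+_ (trans (sumℚ-cong (λ i → *-assoc a (δ i k) (f i))) (sumℚ-*ˡ a (λ i → δ i k * f i))) (sumℚ-combine ws f) ⟩
  a * sumℚ (λ i → δ i k * f i) + combine ws f
    ≡⟨ cong (λ x → a * x + combine ws f) (sumℚ-δ k f) ⟩
  a * f k + combine ws f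
    ∎
  where open ≡-Reasoning

-- Convex combinations

_·_ : Point → Point → ℚ
(α , β) · (x , y) = α * x + β * y

module _ {n} {p : Fin n → Point} {S : Subset n} where

  ·-InConv : ∀ {q} ((w , _) : InConv p S q) ν → ν · q ≡ sumℚ (λ i → w i * (ν · p i))
  ·-InConv {q} (w , _ , _ , _ , Σwx , Σwy) ν@(α , β) = begin
    α * proj₁ q + β * proj₂ q
      ≡⟨ cong₂ (λ x y → α * x + β * y) (sym Σwx) (sym Σwy) ⟩
    α * sumℚ (λ i → w i * proj₁ (p i)) + β * sumℚ (λ i → w i * proj₂ (p i))
      ≡⟨ cong₂ _+_ (sym (sumℚ-*ˡ {n} α _)) (sym (sumℚ-*ˡ {n} β _)) ⟩
    sumℚ (λ i → α * (w i * proj₁ (p i))) + sumℚ (λ i → β * (w i * proj₂ (p i)))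
      ≡⟨ sym (sumℚ-+ {n} _ _) ⟩
    sumℚ (λ i → α * (w i * proj₁ (p i)) + β * (w i * proj₂ (p i)))
      ≡⟨ sumℚ-cong (λ i → regroup α β (w i) (proj₁ (p i)) (proj₂ (p i))) ⟩
    sumℚ (λ i → w i * (ν · p i))
      ∎
    where
    open ≡-Reasoning
    regroup : ∀ a b c x y → a * (c * x) + b * (c * y) ≡ c * (a * x + b * y)
    regroup = solve-∀ ℚ-ring

  InConv-halfplane : ∀ {q} → InConv p S q → ∀ ν c → (∀ i → i ∈ S → ν · p i ≤ c) → ν · q ≤ c
  InConv-halfplane {q} h@(w , w≥0 , w∉S , Σw≡1 , _) ν c below = begin
    ν · q                        ≡⟨ ·-InConv h ν ⟩
    sumℚ (λ i → w i * (ν · p i)) ≤⟨ sumℚ-mono-≤ bound ⟩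
    sumℚ (λ i → c * w i)         ≡⟨ sumℚ-*ˡ c w ⟩
    c * sumℚ w                   ≡⟨ cong (c *_) Σw≡1 ⟩
    c * 1ℚ                       ≡⟨ *-identityʳ c ⟩
    c                            ∎
    where
    open ≤-Reasoning
    bound : ∀ i → w i * (ν · p i) ≤ c * w i
    bound i with i ∈? S
    ... | yes i∈S = subst (_ ≤_) (*-comm (w i) c) (*-monoˡ-≤-nonNeg (w i) {{nonNegative (w≥0 i)}} (below i i∈S))
    ... | no  i∉S rewrite w∉S i i∉S = ≤-reflexive (trans (*-zeroˡ (ν · p i)) (sym (*-zeroʳ c)))

  InConv-concentrated : ∀ {q} ((w , _) : InConv p S q) k → (∀ i → i ≢ k → w i ≡ 0ℚ) → q ≡ p k
  InConv-concentrated (w , _ , _ , Σw≡1 , Σwx , Σwy) k w-off-k =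
    cong₂ _,_ (trans (sym Σwx) (concentrated (proj₁ ∘ p))) (trans (sym Σwy) (concentrated (proj₂ ∘ p)))
    where
    open ≡-Reasoning
    concentrated : ∀ f → sumℚ (λ i → w i * f i) ≡ f k
    concentrated f = begin
      sumℚ (λ i → w i * f i) ≡⟨ sumℚ-supported k (λ i i≢k → trans (cong (_* f i) (w-off-k i i≢k)) (*-zeroˡ (f i))) ⟩
      w k * f k              ≡⟨ cong (_* f k) (trans (sym (sumℚ-supported k w-off-k)) Σw≡1) ⟩
      1ℚ * f k               ≡⟨ *-identityˡ (f k) ⟩
      f k                    ∎

  exposed-vertex : ∀ {q} → InConv p S q → ∀ ν k → (∀ i → i ∈ S → i ≢ k → ν · p k < ν · p i) →
                   ν · q ≤ ν · p k → q ≡ p k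
  exposed-vertex {q} h@(w , w≥0 , w∉S , Σw≡1 , _) ν k above q-below = InConv-concentrated h k w-off-k
    where
    c : ℚ
    c = ν · p k
    excess : Fin n → ℚ
    excess i = w i * (ν · p i - c)
    excess≥0 : ∀ i → 0ℚ ≤ excess i
    excess≥0 i with i ∈? S | i Fin.≟ k
    ... | no i∉S  | _        rewrite w∉S i i∉S = ≤-reflexive (sym (*-zeroˡ (ν · p i - c)))
    ... | yes _   | yes refl rewrite +-inverseʳ c = ≤-reflexive (sym (*-zeroʳ (w k)))
    ... | yes i∈S | no i≢k   = *-nonNeg (w≥0 i) (<⇒≤ (p<q⇒0<q-p (above i i∈S i≢k)))
    Σexcess≤0 : sumℚ excess ≤ 0ℚ
    Σexcess≤0 = begin
      sumℚ excess
        ≡⟨ sumℚ-cong (λ i → split (w i) (ν · p i) c) ⟩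
      sumℚ (λ i → w i * (ν · p i) + (- c) * w i)
        ≡⟨ sumℚ-+ {n} _ _ ⟩
      sumℚ (λ i → w i * (ν · p i)) + sumℚ (λ i → (- c) * w i)
        ≡⟨ cong₂ _+_ (sym (·-InConv h ν)) (trans (sumℚ-*ˡ (- c) w) (cong ((- c) *_) Σw≡1)) ⟩
      ν · q + (- c) * 1ℚ
        ≡⟨ cong (ν · q +_) (*-identityʳ (- c)) ⟩
      ν · q - c
        ≤⟨ +-monoˡ-≤ (- c) q-below ⟩
      c - c
        ≡⟨ +-inverseʳ c ⟩
      0ℚ ∎
      where
      open ≤-Reasoning
      split : ∀ a b c → a * (b - c) ≡ a * b + (- c) * a
      split = solve-∀ ℚ-ring
    w-off-k : ∀ i → i ≢ k → w i ≡ 0ℚ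
    w-off-k i i≢k with i ∈? S
    ... | no  i∉S = w∉S i i∉S
    ... | yes i∈S = p*q≡0⇒p≡0 (nonNeg-sumℚ≤0⇒zero excess≥0 Σexcess≤0 i)
                              (≢-sym (<⇒≢ (p<q⇒0<q-p (above i i∈S i≢k))))

  combination∈hull : ∀ ws → All (λ (a , k) → 0ℚ ≤ a × k ∈ S) ws → combine ws (λ _ → 1ℚ) ≡ 1ℚ →
                     InConv p S (combine ws (proj₁ ∘ p) , combine ws (proj₂ ∘ p))
  combination∈hull ws valid total =
    (λ i → combine ws (δ i)) , weights≥0 ws valid , weights-outside ws valid , Σ≡1 ,
    sumℚ-combine ws (proj₁ ∘ p) , sumℚ-combine ws (proj₂ ∘ p)
    where
    weights≥0 : ∀ ws → All (λ (a , k) → 0ℚ ≤ a × k ∈ S) ws → ∀ i → 0ℚ ≤ combine ws (δ i)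
    weights≥0 []             []                  i = ≤-refl
    weights≥0 ((a , k) ∷ ws) ((a≥0 , _) ∷ valid) i =
      +-mono-≤ {0ℚ} (*-nonNeg a≥0 (δ-nonNeg i k)) (weights≥0 ws valid i)
    weights-outside : ∀ ws → All (λ (a , k) → 0ℚ ≤ a × k ∈ S) ws → ∀ i → i ∉ S → combine ws (δ i) ≡ 0ℚ
    weights-outside []             []                  i i∉S = refl
    weights-outside ((a , k) ∷ ws) ((_ , k∈S) ∷ valid) i i∉S
      rewrite δ-off {i = i} {k} (λ { refl → i∉S k∈S }) | weights-outside ws valid i i∉S =
      trans (+-identityʳ _) (*-zeroʳ a)
    Σ≡1 : sumℚ (λ i → combine ws (δ i)) ≡ 1ℚ
    Σ≡1 = trans (sumℚ-cong (λ i → sym (*-identityʳ (combine ws (δ i))))) (trans (sumℚ-combine ws (λ _ → 1ℚ)) total)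

  vertex∈hull : ∀ k → k ∈ S → InConv p S (p k)
  vertex∈hull k k∈S = subst (InConv p S) (cong₂ _,_ (unit _) (unit _))
                            (combination∈hull ((1ℚ , k) ∷ []) ((≤-by-eval , k∈S) ∷ []) refl)
    where
    unit : ∀ x → 1ℚ * x + 0ℚ ≡ x
    unit x = trans (+-identityʳ _) (*-identityˡ x)

-- Hulls meeting in a single vertex

⟦_⟧ : ∀ {n} → List (Fin n) → Subset n
⟦ vs ⟧ = foldr (λ v S → ⁅ v ⁆ ∪ S) ⊥ vs

∈⟦⟧⁻ : ∀ {n} {i : Fin n} vs → i ∈ ⟦ vs ⟧ → i ∈ₗ vs
∈⟦⟧⁻ []       i∈ = ⊥-elim (∉⊥ i∈)
∈⟦⟧⁻ (v ∷ vs) i∈ with x∈p∪q⁻ ⁅ v ⁆ ⟦ vs ⟧ i∈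
... | inj₁ i∈⁅v⁆ = here (x∈⁅y⁆⇒x≡y v i∈⁅v⁆)
... | inj₂ i∈vs  = there (∈⟦⟧⁻ vs i∈vs)

∈⟦⟧⁺ : ∀ {n} {i : Fin n} {vs} → i ∈ₗ vs → i ∈ ⟦ vs ⟧
∈⟦⟧⁺ (here refl) = x∈p∪q⁺ (inj₁ (x∈⁅x⁆ _))
∈⟦⟧⁺ (there i∈)  = x∈p∪q⁺ (inj₂ (∈⟦⟧⁺ i∈))

All⇒∀∈⟦⟧ : ∀ {n} {Q : Fin n → Set} {vs} → All Q vs → ∀ i → i ∈ ⟦ vs ⟧ → Q i
All⇒∀∈⟦⟧ {vs = vs} all i i∈ = All.lookup all (∈⟦⟧⁻ vs i∈)

Distinct : ∀ {I : Set} → (I → Point) → Set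
Distinct p = ∀ i j → i ≢ j → p i ≢ p j

record Touching {n} (p : Fin n → Point) (S T : Subset n) : Set where
  field
    apex         : Fin n
    apex∈S       : apex ∈ S
    apex∈T       : apex ∈ T
    meet-at-apex : ∀ q → InConv p S q → InConv p T q → q ≡ p apex

orient-rotate : ∀ a b c → orient a b c ≡ orient b c a
orient-rotate (ax , ay) (bx , by) (cx , cy) = rotate ax ay bx by cx cy
  where
  rotate : ∀ ax ay bx by cx cy →
           (bx - ax) * (cy - ay) - (by - ay) * (cx - ax) ≡ (cx - bx) * (ay - by) - (cy - by) * (ax - bx)
  rotate = solve-∀ ℚ-ring

orient-repeated : ∀ a b → orient a a b ≡ 0ℚ
orient-repeated (ax , ay) (bx , by) = repeated ax ay bx by
  where
  repeated : ∀ ax ay bx by → (ax - ax) * (by - ay) - (ay - ay) * (bx - ax) ≡ 0ℚ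
  repeated = solve-∀ ℚ-ring

module _ {n} {p : Fin n → Point} where

  Touching-sym : ∀ {S T} → Touching p S T → Touching p T S
  Touching-sym t = record
    { apex = apex ; apex∈S = apex∈T ; apex∈T = apex∈S
    ; meet-at-apex = λ q q∈T q∈S → meet-at-apex q q∈S q∈T }
    where open Touching t

  Touching⇒meet : ∀ {S T} → Touching p S T → ∃ λ q → InConv p S q × InConv p T q
  Touching⇒meet t = p apex , vertex∈hull apex apex∈S , vertex∈hull apex apex∈T
    where open Touching t

  Touching⇒vertex : ∀ {S T q} → Touching p S T → InConv p S q → InConv p T q → ∃ λ i → p i ≡ q
  Touching⇒vertex {q = q} t q∈S q∈T = apex , sym (meet-at-apex q q∈S q∈T)
    where open Touching t

  Touching⇒⊈ : ∀ {S T i i′} → Distinct p → Touching p S T → i ∈ S → i′ ∈ S → i ≢ i′ → ¬ ConvSub p S T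
  Touching⇒⊈ {S} {T} {i} {i′} distinct t i∈S i′∈S i≢i′ S⊆T =
    distinct i i′ i≢i′ (trans (at-apex i∈S) (sym (at-apex i′∈S)))
    where
    open Touching t
    at-apex : ∀ {j} → j ∈ S → p j ≡ p apex
    at-apex {j} j∈S = meet-at-apex (p j) (vertex∈hull j j∈S) (S⊆T (p j) (vertex∈hull j j∈S))

  touching-by-line : ∀ {vs ws} ν k → k ∈ₗ vs → k ∈ₗ ws →
                     All (λ i → i ≡ k ⊎ ν · p k < ν · p i) vs → All (λ i → ν · p i ≤ ν · p k) ws →
                     Touching p ⟦ vs ⟧ ⟦ ws ⟧
  touching-by-line {vs} {ws} ν k k∈vs k∈ws above below = record
    { apex = k ; apex∈S = ∈⟦⟧⁺ k∈vs ; apex∈T = ∈⟦⟧⁺ k∈ws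
    ; meet-at-apex = λ q q∈S q∈T →
        exposed-vertex q∈S ν k strictly-above (InConv-halfplane q∈T ν (ν · p k) (All⇒∀∈⟦⟧ below)) }
    where
    strictly-above : ∀ i → i ∈ ⟦ vs ⟧ → i ≢ k → ν · p k < ν · p i
    strictly-above i i∈ i≢k with All⇒∀∈⟦⟧ above i i∈
    ... | inj₁ i≡k = ⊥-elim (i≢k i≡k)
    ... | inj₂ k<i = k<i

  ⊈-by-line : ∀ {vs ws i} ν c → i ∈ₗ vs → c < ν · p i → All (λ j → ν · p j ≤ c) ws →
              ¬ ConvSub p ⟦ vs ⟧ ⟦ ws ⟧
  ⊈-by-line {i = i} ν c i∈vs c<i below S⊆T =
    <-irrefl refl (<-≤-trans c<i (InConv-halfplane (S⊆T (p i) (vertex∈hull i (∈⟦⟧⁺ i∈vs))) ν c (All⇒∀∈⟦⟧ below)))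

  segments-touch : ∀ u a b → orient (p u) (p a) (p b) ≢ 0ℚ → Touching p ⟦ u ∷ b ∷ [] ⟧ ⟦ u ∷ a ∷ [] ⟧
  segments-touch u a b o≢0 = touching-by-line ν u (here refl) (here refl)
    (inj₁ refl ∷ inj₂ b-above ∷ []) (≤-refl ∷ ≤-reflexive a-on ∷ [])
    where
    o : ℚ
    o = orient (p u) (p a) (p b)
    -- the normal of the line ua, scaled by o so that b lies on its positive side in either orientation
    ν : Point
    ν = o * (proj₂ (p u) - proj₂ (p a)) , o * (proj₁ (p a) - proj₁ (p u))
    ν-gap : ∀ x → ν · x ≡ ν · p u + o * orient (p u) (p a) x
    ν-gap (x , y) = gap o (proj₁ (p u)) (proj₂ (p u)) (proj₁ (p a)) (proj₂ (p a)) x y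
      where
      gap : ∀ o ux uy ax ay x y →
            o * (uy - ay) * x + o * (ax - ux) * y
              ≡ o * (uy - ay) * ux + o * (ax - ux) * uy + o * ((ax - ux) * (y - uy) - (ay - uy) * (x - ux))
      gap = solve-∀ ℚ-ring
    b-above : ν · p u < ν · p b
    b-above = subst (ν · p u <_) (sym (ν-gap (p b))) (p<p+q (square-pos o≢0))
    a-on : ν · p a ≡ ν · p u
    a-on = begin
      ν · p a                               ≡⟨ ν-gap (p a) ⟩
      ν · p u + o * orient (p u) (p a) (p a) ≡⟨ cong (λ z → ν · p u + o * z) (trans (orient-rotate (p u) (p a) (p a)) (orient-repeated (p a) (p u))) ⟩
      ν · p u + o * 0ℚ                      ≡⟨ cong (ν · p u +_) (*-zeroʳ o) ⟩
      ν · p u + 0ℚ                          ≡⟨ +-identityʳ _ ⟩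
      ν · p u                               ∎
      where open ≡-Reasoning

-- The parabola

parabola : ℚ → Point
parabola t = t , t * t

lowerBound upperBound : Point → ℚ
lowerBound (α , β) = (α ⊓ 0ℚ) + (β ⊓ 0ℚ)
upperBound (α , β) = (α ⊔ 0ℚ) + (β ⊔ 0ℚ)

module _ {s} (0≤s : 0ℚ ≤ s) (s≤1 : s ≤ 1ℚ) where

  α⊓0≤α*s : ∀ α → α ⊓ 0ℚ ≤ α * s
  α⊓0≤α*s α with α ≤? 0ℚ
  ... | yes α≤0 = subst₂ _≤_ (trans (*-identityʳ α) (sym (p≤q⇒p⊓q≡p α≤0))) refl
                         (*-monoˡ-≤-nonPos α {{nonPositive α≤0}} s≤1)
  ... | no  α≰0 = subst (_≤ α * s) (sym (p≥q⇒p⊓q≡q (<⇒≤ (≰⇒> α≰0)))) (*-nonNeg (<⇒≤ (≰⇒> α≰0)) 0≤s)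

  α*s≤α⊔0 : ∀ α → α * s ≤ α ⊔ 0ℚ
  α*s≤α⊔0 α with α ≤? 0ℚ
  ... | yes α≤0 = subst₂ _≤_ refl (trans (*-zeroʳ α) (sym (p≤q⇒p⊔q≡q α≤0)))
                         (*-monoˡ-≤-nonPos α {{nonPositive α≤0}} 0≤s)
  ... | no  α≰0 = subst (α * s ≤_) (trans (*-identityʳ α) (sym (p≥q⇒p⊔q≡p (<⇒≤ (≰⇒> α≰0)))))
                        (*-monoˡ-≤-nonNeg α {{nonNegative (<⇒≤ (≰⇒> α≰0))}} s≤1)

module _ {t} (0≤t : 0ℚ ≤ t) (t≤1 : t ≤ 1ℚ) where

  private
    0≤t² : 0ℚ ≤ t * t
    0≤t² = *-nonNeg 0≤t 0≤t
    t²≤1 : t * t ≤ 1ℚ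
    t²≤1 = ≤-trans (*-monoˡ-≤-nonNeg t {{nonNegative 0≤t}} t≤1) (subst (_≤ 1ℚ) (sym (*-identityʳ t)) t≤1)

  lowerBound≤·parabola : ∀ ν → lowerBound ν ≤ ν · parabola t
  lowerBound≤·parabola (α , β) = +-mono-≤ (α⊓0≤α*s 0≤t t≤1 α) (α⊓0≤α*s 0≤t² t²≤1 β)

  ·parabola≤upperBound : ∀ ν → ν · parabola t ≤ upperBound ν
  ·parabola≤upperBound (α , β) = +-mono-≤ (α*s≤α⊔0 0≤t t≤1 α) (α*s≤α⊔0 0≤t² t²≤1 β)

  affine-parabola≢0 : ∀ c ν → 0ℚ < c + lowerBound ν ⊎ c + upperBound ν < 0ℚ → c + ν · parabola t ≢ 0ℚ
  affine-parabola≢0 c ν (inj₁ pos) = ≢-sym (<⇒≢ (<-≤-trans pos (+-monoʳ-≤ c (lowerBound≤·parabola ν))))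
  affine-parabola≢0 c ν (inj₂ neg) = <⇒≢ (≤-<-trans (+-monoʳ-≤ c (·parabola≤upperBound ν)) neg)

·parabola-pos : ∀ {α β t} → 0ℚ ≤ α → 0ℚ < β → 0ℚ < t → 0ℚ < (α , β) · parabola t
·parabola-pos 0≤α 0<β 0<t = +-mono-≤-< (*-nonNeg 0≤α (<⇒≤ 0<t)) (*-pos 0<β (*-pos 0<t 0<t))

tangent : ℚ → Point
tangent t = -2 * t , 1ℚ

tangent-gap : ∀ t x y → tangent t · (x , y) ≡ tangent t · parabola t + (y + (-2 * x , 1ℚ) · parabola t)
tangent-gap = gap
  where
  gap : ∀ t x y → -2 * t * x + 1ℚ * y ≡ -2 * t * t + 1ℚ * (t * t) + (y + (-2 * x * t + 1ℚ * (t * t)))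
  gap = solve-∀ ℚ-ring

parabola-above-tangent : ∀ {s t} → s ≢ t → tangent t · parabola t < tangent t · parabola s
parabola-above-tangent {s} {t} s≢t =
  subst (_ <_) (sym (gap s t)) (p<p+q (square-pos (p≢q⇒p-q≢0 s≢t)))
  where
  gap : ∀ s t → -2 * t * s + 1ℚ * (s * s) ≡ -2 * t * t + 1ℚ * (t * t) + (s - t) * (s - t)
  gap = solve-∀ ℚ-ring

quadrant-above-tangent : ∀ {t} q → proj₁ q ≤ 0ℚ → 0ℚ ≤ proj₂ q → 0ℚ < t →
                         tangent t · parabola t < tangent t · q
quadrant-above-tangent {t} (x , y) x≤0 0≤y 0<t =
  subst (_ <_) (sym (tangent-gap t x y)) (p<p+q (+-mono-≤-< 0≤y (·parabola-pos {β = 1ℚ} 0≤-2x <-by-eval 0<t)))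
  where
  0≤-2x : 0ℚ ≤ -2 * x
  0≤-2x = *-monoˡ-≤-nonPos -2 {{nonPositive { -2} ≤-by-eval}} x≤0

below-tangent : ∀ {t} q → proj₂ q + upperBound (-2 * proj₁ q , 1ℚ) ≤ 0ℚ → 0ℚ ≤ t → t ≤ 1ℚ →
                tangent t · q ≤ tangent t · parabola t
below-tangent {t} (x , y) gap≤0 0≤t t≤1 = begin
  tangent t · (x , y)
    ≡⟨ tangent-gap t x y ⟩
  tangent t · parabola t + (y + (-2 * x , 1ℚ) · parabola t)
    ≤⟨ +-monoʳ-≤ (tangent t · parabola t) (≤-trans (+-monoʳ-≤ y (·parabola≤upperBound 0≤t t≤1 (-2 * x , 1ℚ))) gap≤0) ⟩
  tangent t · parabola t + 0ℚ
    ≡⟨ +-identityʳ _ ⟩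
  tangent t · parabola t
    ∎
  where open ≤-Reasoning

-- General position

NoThreeCollinear : ∀ {I : Set} → (I → Point) → Set
NoThreeCollinear p = ∀ i j k → i ≢ j → j ≢ k → i ≢ k → orient (p i) (p j) (p k) ≢ 0ℚ

NoThreeCollinear⇒Distinct : ∀ {I} {p : I → Point} → (∀ i j → ∃ λ k → i ≢ k × j ≢ k) →
                            NoThreeCollinear p → Distinct p
NoThreeCollinear⇒Distinct {p = p} third noThree i j i≢j pi≡pj with third i j
... | k , i≢k , j≢k = noThree i j k i≢j j≢k i≢k
  (trans (cong (λ x → orient x (p j) (p k)) pi≡pj) (orient-repeated (p j) (p k)))

third-index : ∀ {n} (i j : Fin (3 ℕ.+ n)) → ∃ λ k → i ≢ k × j ≢ k
third-index zero          zero          = suc zero       , (λ ()) , (λ ())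
third-index zero          (suc zero)    = suc (suc zero) , (λ ()) , (λ ())
third-index zero          (suc (suc _)) = suc zero       , (λ ()) , (λ ())
third-index (suc zero)    zero          = suc (suc zero) , (λ ()) , (λ ())
third-index (suc zero)    (suc _)       = zero           , (λ ()) , (λ ())
third-index (suc (suc _)) zero          = suc zero       , (λ ()) , (λ ())
third-index (suc (suc _)) (suc _)       = zero           , (λ ()) , (λ ())

orient-rotate-≢0 : ∀ a b c → orient b c a ≢ 0ℚ → orient a b c ≢ 0ℚ
orient-rotate-≢0 a b c ≢0 = ≢0 ∘ trans (sym (orient-rotate a b c))

NoThreeCollinear-∘ : ∀ {I J} {p : J → Point} {f : I → J} → (∀ {i j} → f i ≡ f j → i ≡ j) →
                     NoThreeCollinear p → NoThreeCollinear (p ∘ f)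
NoThreeCollinear-∘ {f = f} f-injective noThree i j k i≢j j≢k i≢k =
  noThree (f i) (f j) (f k) (i≢j ∘ f-injective) (j≢k ∘ f-injective) (i≢k ∘ f-injective)

NoThreeCollinear-⊎ : ∀ {I J} {f : I → Point} {g : J → Point} →
  NoThreeCollinear f → NoThreeCollinear g →
  (∀ x x′ y → x ≢ x′ → orient (f x) (f x′) (g y) ≢ 0ℚ) →
  (∀ x y y′ → y ≢ y′ → orient (f x) (g y) (g y′) ≢ 0ℚ) →
  NoThreeCollinear [ f , g ]′
NoThreeCollinear-⊎ F G FFG FGG (inj₁ x) (inj₁ x′) (inj₁ x″) ≢₁ ≢₂ ≢₃ =
  F x x′ x″ (≢₁ ∘ cong inj₁) (≢₂ ∘ cong inj₁) (≢₃ ∘ cong inj₁)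
NoThreeCollinear-⊎ F G FFG FGG (inj₁ x) (inj₁ x′) (inj₂ y)  ≢₁ _  _  = FFG x x′ y (≢₁ ∘ cong inj₁)
NoThreeCollinear-⊎ {f = f} {g} F G FFG FGG (inj₁ x) (inj₂ y)  (inj₁ x′) _  _  ≢₃ =
  orient-rotate-≢0 (f x) (g y) (f x′) (orient-rotate-≢0 (g y) (f x′) (f x) (FFG x′ x y (≢₃ ∘ cong inj₁ ∘ sym)))
NoThreeCollinear-⊎ {f = f} {g} F G FFG FGG (inj₂ y) (inj₁ x)  (inj₁ x′) _  ≢₂ _  =
  orient-rotate-≢0 (g y) (f x) (f x′) (FFG x x′ y (≢₂ ∘ cong inj₁))
NoThreeCollinear-⊎ F G FFG FGG (inj₁ x) (inj₂ y)  (inj₂ y′) _  ≢₂ _  = FGG x y y′ (≢₂ ∘ cong inj₂)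
NoThreeCollinear-⊎ {f = f} {g} F G FFG FGG (inj₂ y) (inj₁ x)  (inj₂ y′) _  _  ≢₃ =
  orient-rotate-≢0 (g y) (f x) (g y′) (FGG x y′ y (≢₃ ∘ cong inj₂ ∘ sym))
NoThreeCollinear-⊎ {f = f} {g} F G FFG FGG (inj₂ y) (inj₂ y′) (inj₁ x)  ≢₁ _  _  =
  orient-rotate-≢0 (g y) (g y′) (f x) (orient-rotate-≢0 (g y′) (f x) (g y) (FGG x y y′ (≢₁ ∘ cong inj₂)))
NoThreeCollinear-⊎ F G FFG FGG (inj₂ y) (inj₂ y′) (inj₂ y″) ≢₁ ≢₂ ≢₃ =
  G y y′ y″ (≢₁ ∘ cong inj₂) (≢₂ ∘ cong inj₂) (≢₃ ∘ cong inj₂)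

normal : Point → Point → Point
normal (fx , fy) (gx , gy) = fy - gy , gx - fx

orient-affine : ∀ f g q → orient f g q ≡ orient f g (0ℚ , 0ℚ) + normal f g · q
orient-affine (fx , fy) (gx , gy) (x , y) = affine fx fy gx gy x y
  where
  affine : ∀ fx fy gx gy x y → (gx - fx) * (y - fy) - (gy - fy) * (x - fx)
           ≡ (gx - fx) * (0ℚ - fy) - (gy - fy) * (0ℚ - fx) + ((fy - gy) * x + (gx - fx) * y)
  affine = solve-∀ ℚ-ring

orient-chord : ∀ f s t → orient f (parabola s) (parabola t) ≡ (t - s) * (s * t + (- proj₁ f) * (s + t) + proj₂ f)
orient-chord (fx , fy) s t = chord fx fy s t
  where
  chord : ∀ fx fy s t → (s - fx) * (t * t - fy) - (s * s - fy) * (t - fx) ≡ (t - s) * (s * t + (- fx) * (s + t) + fy)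
  chord = solve-∀ ℚ-ring

orient-parabola³ : ∀ s t w → orient (parabola s) (parabola t) (parabola w) ≡ (t - s) * ((w - s) * (w - t))
orient-parabola³ = vandermonde
  where
  vandermonde : ∀ s t w → (t - s) * (w * w - s * s) - (t * t - s * s) * (w - s) ≡ (t - s) * ((w - s) * (w - t))
  vandermonde = solve-∀ ℚ-ring

parabola-noThreeCollinear : ∀ {I} {t : I → ℚ} → (∀ {i j} → t i ≡ t j → i ≡ j) → NoThreeCollinear (parabola ∘ t)
parabola-noThreeCollinear {t = t} t-injective i j k i≢j j≢k i≢k =
  p*q≢0 (≢-of i≢j) (p*q≢0 (≢-of i≢k) (≢-of j≢k)) ∘ trans (sym (orient-parabola³ (t i) (t j) (t k)))
  where
  ≢-of : ∀ {a b} → a ≢ b → t b - t a ≢ 0ℚ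
  ≢-of a≢b = p≢q⇒p-q≢0 (a≢b ∘ t-injective ∘ sym)

-- Sufficient for orient f g (parabola t) to keep one sign for t ∈ [0, 1] (see orient-affine).
ArcSignDefinite : Point → Point → Set
ArcSignDefinite f g = 0ℚ < c + lowerBound (normal f g) ⊎ c + upperBound (normal f g) < 0ℚ
  where c = orient f g (0ℚ , 0ℚ)

arcSignDefinite? : ∀ f g → Dec (ArcSignDefinite f g)
arcSignDefinite? f g = (0ℚ <? _) ⊎-dec (_ <? 0ℚ)

orient-parabola≢0 : ∀ f g {t} → ArcSignDefinite f g → 0ℚ ≤ t → t ≤ 1ℚ → orient f g (parabola t) ≢ 0ℚ
orient-parabola≢0 f g {t} definite 0≤t t≤1 =
  affine-parabola≢0 0≤t t≤1 (orient f g (0ℚ , 0ℚ)) (normal f g) definite ∘ trans (sym (orient-affine f g (parabola t)))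

-- Sufficient for f to lie off every chord of the parabola between parameters in (0, 1] (see orient-chord).
AvoidsChords : Point → Set
AvoidsChords (x , y) = 0ℚ ≤ - x × (0ℚ ≤ y ⊎ 1ℚ + (- x) * 2 + y < 0ℚ)

avoidsChords? : ∀ f → Dec (AvoidsChords f)
avoidsChords? (x , y) = (0ℚ ≤? - x) ×-dec ((0ℚ ≤? y) ⊎-dec (1ℚ + (- x) * 2 + y <? 0ℚ))

orient-chord≢0 : ∀ {f s t} → AvoidsChords f → 0ℚ < s → s ≤ 1ℚ → 0ℚ < t → t ≤ 1ℚ → s ≢ t →
                 orient f (parabola s) (parabola t) ≢ 0ℚ
orient-chord≢0 {f@(x , y)} {s} {t} (0≤-x , side) 0<s s≤1 0<t t≤1 s≢t =
  p*q≢0 (p≢q⇒p-q≢0 (s≢t ∘ sym)) (factor≢0 side) ∘ trans (sym (orient-chord f s t))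
  where
  factor≢0 : 0ℚ ≤ y ⊎ 1ℚ + (- x) * 2 + y < 0ℚ → s * t + (- x) * (s + t) + y ≢ 0ℚ
  factor≢0 (inj₁ 0≤y) = ≢-sym (<⇒≢ (+-mono-<-≤ (+-mono-<-≤ (*-pos 0<s 0<t)
                          (*-nonNeg 0≤-x (<⇒≤ (+-mono-< 0<s 0<t)))) 0≤y))
  factor≢0 (inj₂ neg) = <⇒≢ (≤-<-trans (+-monoˡ-≤ y (+-mono-≤ st≤1
                          (*-monoˡ-≤-nonNeg (- x) {{nonNegative 0≤-x}} (+-mono-≤ s≤1 t≤1)))) neg)
    where
    st≤1 : s * t ≤ 1ℚ
    st≤1 = ≤-trans (*-monoʳ-≤-nonNeg t {{nonNegative (<⇒≤ 0<t)}} s≤1) (subst (_≤ 1ℚ) (sym (*-identityˡ t)) t≤1)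

-- The construction

two-agree : ∀ (x y z : Bool) → x ≡ y ⊎ y ≡ z ⊎ x ≡ z
two-agree false false _     = inj₁ refl
two-agree true  true  _     = inj₁ refl
two-agree false true  true  = inj₂ (inj₁ refl)
two-agree true  false false = inj₂ (inj₁ refl)
two-agree false true  false = inj₂ (inj₂ refl)
two-agree true  false true  = inj₂ (inj₂ refl)

pattern 1st = here refl
pattern 2nd = there (here refl)
pattern 3rd = there (there (here refl))

pattern U   = zero
pattern V   = suc zero
pattern R   = suc (suc zero)
pattern A   = suc (suc (suc zero))
pattern B   = suc (suc (suc (suc zero)))
pattern L j = suc (suc (suc (suc (suc j))))

corner : Fin 5 → Point
corner U = -3 , -8
corner V = -3 , -12
corner R = -4 , 8
corner A = -1 , 0
corner B = -2 , 2

corners-noThreeCollinear : NoThreeCollinear corner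
corners-noThreeCollinear = from-yes (Fin.all? λ i → Fin.all? λ j → Fin.all? λ k →
  ¬? (i Fin.≟ j) →-dec ¬? (j Fin.≟ k) →-dec ¬? (i Fin.≟ k) →-dec ¬? (orient (corner i) (corner j) (corner k) ≟ 0ℚ))

corner-pairs-arcSignDefinite : ∀ x x′ → x ≢ x′ → ArcSignDefinite (corner x) (corner x′)
corner-pairs-arcSignDefinite = from-yes (Fin.all? λ x → Fin.all? λ x′ →
  ¬? (x Fin.≟ x′) →-dec arcSignDefinite? (corner x) (corner x′))

corners-avoidChords : ∀ x → AvoidsChords (corner x)
corners-avoidChords = from-yes (Fin.all? (avoidsChords? ∘ corner))

-- Hulls are named by their vertices: L stands for all parabola points, UL j is the segment from U to L j.
pattern UVR  = zero
pattern UAB  = suc zero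
pattern VAB  = suc (suc zero)
pattern URB  = suc (suc (suc zero))
pattern RBL  = suc (suc (suc (suc zero)))
pattern RAL  = suc (suc (suc (suc (suc zero))))
pattern UL j = suc (suc (suc (suc (suc (suc j)))))

module Construction (m : ℕ) where

  -- t j = 1 / (j + 1)
  t : Fin m → ℚ
  t j = mkℚ 1 (toℕ j) (1-coprimeTo (suc (toℕ j)))

  0<t : ∀ j → 0ℚ < t j
  0<t j = *<* (ℤ.+<+ (s≤s z≤n))

  0≤t : ∀ j → 0ℚ ≤ t j
  0≤t j = <⇒≤ (0<t j)

  t≤1 : ∀ j → t j ≤ 1ℚ
  t≤1 j = *≤* (ℤ.+≤+ (s≤s z≤n))

  t-injective : ∀ {j k} → t j ≡ t k → j ≡ k
  t-injective tj≡tk = Fin.toℕ-injective (cong ℚ.denominator-1 tj≡tk)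

  P : Fin (5 ℕ.+ m) → Point
  P = [ corner , parabola ∘ t ]′ ∘ splitAt 5

  P-noThreeCollinear : NoThreeCollinear P
  P-noThreeCollinear = NoThreeCollinear-∘ {p = [ corner , parabola ∘ t ]′} {f = splitAt 5}
    (Injection.injective (↔⇒↣ (Fin.+↔⊎ {5} {m})))
    (NoThreeCollinear-⊎ {f = corner} {g = parabola ∘ t} corners-noThreeCollinear
      (parabola-noThreeCollinear {t = t} t-injective)
      (λ x x′ j x≢x′ → orient-parabola≢0 (corner x) (corner x′) (corner-pairs-arcSignDefinite x x′ x≢x′) (0≤t j) (t≤1 j))
      (λ x j j′ j≢j′ → orient-chord≢0 (corners-avoidChords x) (0<t j) (t≤1 j) (0<t j′) (t≤1 j′) (j≢j′ ∘ t-injective)))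

  P-generalPosition : GeneralPosition P
  P-generalPosition = NoThreeCollinear⇒Distinct third-index P-noThreeCollinear , P-noThreeCollinear

  vertices : Fin (6 ℕ.+ m) → List (Fin (5 ℕ.+ m))
  vertices UVR    = U ∷ V ∷ R ∷ []
  vertices UAB    = U ∷ A ∷ B ∷ []
  vertices VAB    = V ∷ A ∷ B ∷ []
  vertices URB    = U ∷ R ∷ B ∷ []
  vertices RBL    = R ∷ B ∷ List.tabulate L
  vertices RAL    = R ∷ A ∷ List.tabulate L
  vertices (UL j) = U ∷ L j ∷ []

  hull : Fin (6 ℕ.+ m) → Subset (5 ℕ.+ m)
  hull h = ⟦ vertices h ⟧

  ∈hull : ∀ h {i} → i ∈ₗ vertices h → i ∈ hull h
  ∈hull h = ∈⟦⟧⁺ {vs = vertices h}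

  parabola-above : ∀ ν {c} {_ : True (c <? lowerBound ν)} j → c < ν · P (L j)
  parabola-above ν {_} {c<} j = <-≤-trans (toWitness c<) (lowerBound≤·parabola (0≤t j) (t≤1 j) ν)

  parabola-below : ∀ ν {c} {_ : True (upperBound ν ≤? c)} j → ν · P (L j) ≤ c
  parabola-below ν {_} {≤c} j = ≤-trans (·parabola≤upperBound (0≤t j) (t≤1 j) ν) (toWitness ≤c)

  touching : ∀ h h′ ν k → k ∈ₗ vertices h → k ∈ₗ vertices h′ →
             All (λ i → i ≡ k ⊎ ν · P k < ν · P i) (vertices h) → All (λ i → ν · P i ≤ ν · P k) (vertices h′) →
             Touching P (hull h) (hull h′)
  touching h h′ = touching-by-line {vs = vertices h} {ws = vertices h′}

  UAB-UVR : Touching P (hull UAB) (hull UVR)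
  UAB-UVR = touching UAB UVR (17 , 1) U 1st 1st
    (inj₁ refl ∷ inj₂ <-by-eval ∷ inj₂ <-by-eval ∷ []) (≤-by-eval ∷ ≤-by-eval ∷ ≤-by-eval ∷ [])

  VAB-UVR : Touching P (hull VAB) (hull UVR)
  VAB-UVR = touching VAB UVR (15 , -1) V 1st 2nd
    (inj₁ refl ∷ inj₂ <-by-eval ∷ inj₂ <-by-eval ∷ []) (≤-by-eval ∷ ≤-by-eval ∷ ≤-by-eval ∷ [])

  RBL-UVR : Touching P (hull RBL) (hull UVR)
  RBL-UVR = touching RBL UVR (4 , 1) R 1st 3rd
    (inj₁ refl ∷ inj₂ <-by-eval ∷ tabulate⁺ (inj₂ ∘ parabola-above (4 , 1)))
    (≤-by-eval ∷ ≤-by-eval ∷ ≤-by-eval ∷ [])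

  RAL-UVR : Touching P (hull RAL) (hull UVR)
  RAL-UVR = touching RAL UVR (3 , 1) R 1st 3rd
    (inj₁ refl ∷ inj₂ <-by-eval ∷ tabulate⁺ (inj₂ ∘ parabola-above (3 , 1)))
    (≤-by-eval ∷ ≤-by-eval ∷ ≤-by-eval ∷ [])

  UL-UVR : ∀ j → Touching P (hull (UL j)) (hull UVR)
  UL-UVR j = touching (UL j) UVR (17 , 1) U 1st 1st
    (inj₁ refl ∷ inj₂ (parabola-above (17 , 1) j) ∷ []) (≤-by-eval ∷ ≤-by-eval ∷ ≤-by-eval ∷ [])

  RBL-UAB : Touching P (hull RBL) (hull UAB)
  RBL-UAB = touching RBL UAB (3 , 2) B 2nd 3rd
    (inj₂ <-by-eval ∷ inj₁ refl ∷ tabulate⁺ (inj₂ ∘ parabola-above (3 , 2)))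
    (≤-by-eval ∷ ≤-by-eval ∷ ≤-by-eval ∷ [])

  RAL-UAB : Touching P (hull RAL) (hull UAB)
  RAL-UAB = touching RAL UAB (5 , 2) A 2nd 2nd
    (inj₂ <-by-eval ∷ inj₁ refl ∷ tabulate⁺ (inj₂ ∘ parabola-above (5 , 2)))
    (≤-by-eval ∷ ≤-by-eval ∷ ≤-by-eval ∷ [])

  UL-UAB : ∀ j → Touching P (hull (UL j)) (hull UAB)
  UL-UAB j = touching (UL j) UAB (7 , -2) U 1st 1st
    (inj₁ refl ∷ inj₂ (parabola-above (7 , -2) j) ∷ []) (≤-by-eval ∷ ≤-by-eval ∷ ≤-by-eval ∷ [])

  RBL-VAB : Touching P (hull RBL) (hull VAB)
  RBL-VAB = touching RBL VAB (3 , 2) B 2nd 3rd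
    (inj₂ <-by-eval ∷ inj₁ refl ∷ tabulate⁺ (inj₂ ∘ parabola-above (3 , 2)))
    (≤-by-eval ∷ ≤-by-eval ∷ ≤-by-eval ∷ [])

  RAL-VAB : Touching P (hull RAL) (hull VAB)
  RAL-VAB = touching RAL VAB (5 , 2) A 2nd 2nd
    (inj₂ <-by-eval ∷ inj₁ refl ∷ tabulate⁺ (inj₂ ∘ parabola-above (5 , 2)))
    (≤-by-eval ∷ ≤-by-eval ∷ ≤-by-eval ∷ [])

  URB-VAB : Touching P (hull URB) (hull VAB)
  URB-VAB = touching URB VAB (-11 , 1) B 3rd 3rd
    (inj₂ <-by-eval ∷ inj₂ <-by-eval ∷ inj₁ refl ∷ []) (≤-by-eval ∷ ≤-by-eval ∷ ≤-by-eval ∷ [])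

  RAL-URB : Touching P (hull RAL) (hull URB)
  RAL-URB = touching RAL URB (11 , 4) R 1st 2nd
    (inj₁ refl ∷ inj₂ <-by-eval ∷ tabulate⁺ (inj₂ ∘ parabola-above (11 , 4)))
    (≤-by-eval ∷ ≤-by-eval ∷ ≤-by-eval ∷ [])

  UL-URB : ∀ j → Touching P (hull (UL j)) (hull URB)
  UL-URB j = touching (UL j) URB (4 , -1) U 1st 1st
    (inj₁ refl ∷ inj₂ (parabola-above (4 , -1) j) ∷ []) (≤-by-eval ∷ ≤-by-eval ∷ ≤-by-eval ∷ [])

  parabola-vs-tangent : ∀ j k → _≡_ {A = Fin (5 ℕ.+ m)} (L k) (L j) ⊎ tangent (t j) · P (L j) < tangent (t j) · P (L k)
  parabola-vs-tangent j k with k Fin.≟ j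
  ... | yes refl = inj₁ refl
  ... | no  k≢j  = inj₂ (parabola-above-tangent (k≢j ∘ t-injective))

  RBL-UL : ∀ j → Touching P (hull RBL) (hull (UL j))
  RBL-UL j = touching RBL (UL j) (tangent (t j)) (L j) (there (there (∈-tabulate⁺ {f = L} j))) 2nd
    (inj₂ (quadrant-above-tangent (P R) ≤-by-eval ≤-by-eval (0<t j)) ∷
     inj₂ (quadrant-above-tangent (P B) ≤-by-eval ≤-by-eval (0<t j)) ∷ tabulate⁺ (parabola-vs-tangent j))
    (below-tangent (P U) ≤-by-eval (0≤t j) (t≤1 j) ∷ ≤-refl ∷ [])

  RAL-UL : ∀ j → Touching P (hull RAL) (hull (UL j))
  RAL-UL j = touching RAL (UL j) (tangent (t j)) (L j) (there (there (∈-tabulate⁺ {f = L} j))) 2nd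
    (inj₂ (quadrant-above-tangent (P R) ≤-by-eval ≤-by-eval (0<t j)) ∷
     inj₂ (quadrant-above-tangent (P A) ≤-by-eval ≤-by-eval (0<t j)) ∷ tabulate⁺ (parabola-vs-tangent j))
    (below-tangent (P U) ≤-by-eval (0≤t j) (t≤1 j) ∷ ≤-refl ∷ [])

  UL-UL : ∀ j k → j ≢ k → Touching P (hull (UL k)) (hull (UL j))
  UL-UL j k j≢k = segments-touch U (L j) (L k)
    (P-noThreeCollinear U (L j) (L k) (λ ()) (λ { refl → j≢k refl }) (λ ()))

  not-inside : ∀ h h′ {i} ν c → i ∈ₗ vertices h → c < ν · P i → All (λ j → ν · P j ≤ c) (vertices h′) →
               ¬ ConvSub P (hull h) (hull h′)
  not-inside h h′ = ⊈-by-line {vs = vertices h} {ws = vertices h′}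

  shared-vertex : ∀ h h′ {i} → i ∈ₗ vertices h → i ∈ₗ vertices h′ →
                  ∃ λ q → InConv P (hull h) q × InConv P (hull h′) q
  shared-vertex h h′ {i} i∈h i∈h′ = P i , vertex∈hull {p = P} i (∈hull h i∈h) , vertex∈hull {p = P} i (∈hull h′ i∈h′)

  UL-meets-VAB : ∀ j → ∃ λ q → InConv P (hull (UL j)) q × InConv P (hull VAB) q
  UL-meets-VAB j = q , on-segment , in-triangle
    where
    s : ℚ
    s = t j
    q : Point
    q = 4 / 5 * -3 + (1 / 5 * s + 0ℚ) , 4 / 5 * -8 + (1 / 5 * (s * s) + 0ℚ)
    on-segment : InConv P (hull (UL j)) q
    on-segment = combination∈hull {p = P} ((4 / 5 , U) ∷ (1 / 5 , L j) ∷ [])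
      ((≤-by-eval , ∈hull (UL j) 1st) ∷ (≤-by-eval , ∈hull (UL j) 2nd) ∷ []) refl
    weight≥0 : ∀ c ν {_ : True (0ℚ ≤? c + lowerBound ν)} → 0ℚ ≤ c + ν · parabola s
    weight≥0 c ν {0≤} = ≤-trans (toWitness 0≤) (+-monoʳ-≤ c (lowerBound≤·parabola (0≤t j) (t≤1 j) ν))
    -- the weights are the barycentric coordinates of q with respect to V, A, B
    in-triangle : InConv P (hull VAB) q
    in-triangle = subst (InConv P (hull VAB)) (cong₂ _,_ (x-agrees s) (y-agrees s)) (combination∈hull {p = P}
      ((23 / 40 + (-1 / 40 , -1 / 80) · parabola s , V) ∷
       (7 / 40 + (7 / 40 , -1 / 80) · parabola s , A) ∷
       (1 / 4 + (-3 / 20 , 1 / 40) · parabola s , B) ∷ [])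
      ((weight≥0 (23 / 40) (-1 / 40 , -1 / 80) , ∈hull VAB 1st) ∷
       (weight≥0 (7 / 40) (7 / 40 , -1 / 80) , ∈hull VAB 2nd) ∷
       (weight≥0 (1 / 4) (-3 / 20 , 1 / 40) , ∈hull VAB 3rd) ∷ [])
      (total s))
      where
      total : ∀ t → (23 / 40 + (-1 / 40 * t + -1 / 80 * (t * t))) * 1ℚ
                    + ((7 / 40 + (7 / 40 * t + -1 / 80 * (t * t))) * 1ℚ
                    + ((1 / 4 + (-3 / 20 * t + 1 / 40 * (t * t))) * 1ℚ + 0ℚ)) ≡ 1ℚ
      total = solve-∀ ℚ-ring
      x-agrees : ∀ t → (23 / 40 + (-1 / 40 * t + -1 / 80 * (t * t))) * -3
                       + ((7 / 40 + (7 / 40 * t + -1 / 80 * (t * t))) * -1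
                       + ((1 / 4 + (-3 / 20 * t + 1 / 40 * (t * t))) * -2 + 0ℚ))
                     ≡ 4 / 5 * -3 + (1 / 5 * t + 0ℚ)
      x-agrees = solve-∀ ℚ-ring
      y-agrees : ∀ t → (23 / 40 + (-1 / 40 * t + -1 / 80 * (t * t))) * -12
                       + ((7 / 40 + (7 / 40 * t + -1 / 80 * (t * t))) * 0ℚ
                       + ((1 / 4 + (-3 / 20 * t + 1 / 40 * (t * t))) * 2 + 0ℚ))
                     ≡ 4 / 5 * -8 + (1 / 5 * (t * t) + 0ℚ)
      y-agrees = solve-∀ ℚ-ring

  -- The pairs of hulls that do not touch; each joins side false to side true.
  data Crossing : Fin (6 ℕ.+ m) → Fin (6 ℕ.+ m) → Set where
    UVR×URB : Crossing UVR URB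
    UAB×VAB : Crossing UAB VAB
    UAB×URB : Crossing UAB URB
    RBL×RAL : Crossing RBL RAL
    RBL×URB : Crossing RBL URB
    UL×VAB  : ∀ j → Crossing (UL j) VAB

  side : Fin (6 ℕ.+ m) → Bool
  side VAB = true
  side URB = true
  side RAL = true
  side _   = false

  crossing-sides : ∀ {h h′} → Crossing h h′ → side h ≢ side h′
  crossing-sides UVR×URB   ()
  crossing-sides UAB×VAB   ()
  crossing-sides UAB×URB   ()
  crossing-sides RBL×RAL   ()
  crossing-sides RBL×URB   ()
  crossing-sides (UL×VAB j) ()

  crossing-meet : ∀ {h h′} → Crossing h h′ → ∃ λ q → InConv P (hull h) q × InConv P (hull h′) q
  crossing-meet UVR×URB    = shared-vertex UVR URB 1st 1st
  crossing-meet UAB×VAB    = shared-vertex UAB VAB 2nd 2nd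
  crossing-meet UAB×URB    = shared-vertex UAB URB 1st 1st
  crossing-meet RBL×RAL    = shared-vertex RBL RAL 1st 1st
  crossing-meet RBL×URB    = shared-vertex RBL URB 1st 2nd
  crossing-meet (UL×VAB j) = UL-meets-VAB j

  -- RBL ⊄ URB is witnessed by a parabola point.
  crossing-⊈ : ∀ {h h′} → Fin m → Crossing h h′ → ¬ ConvSub P (hull h) (hull h′)
  crossing-⊈ _  UVR×URB    = not-inside UVR URB (0 , -1) 8 2nd <-by-eval (≤-by-eval ∷ ≤-by-eval ∷ ≤-by-eval ∷ [])
  crossing-⊈ _  UAB×VAB    = not-inside UAB VAB (-11 , 1) 24 1st <-by-eval (≤-by-eval ∷ ≤-by-eval ∷ ≤-by-eval ∷ [])
  crossing-⊈ _  UAB×URB    = not-inside UAB URB (1 , 0) -2 2nd <-by-eval (≤-by-eval ∷ ≤-by-eval ∷ ≤-by-eval ∷ [])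
  crossing-⊈ _  RBL×RAL    = not-inside RBL RAL (-5 , -2) 5 2nd <-by-eval
    (≤-by-eval ∷ ≤-by-eval ∷ tabulate⁺ (parabola-below (-5 , -2)))
  crossing-⊈ j₀ RBL×URB    = not-inside RBL URB (1 , 0) -2 (there (there (∈-tabulate⁺ {f = L} j₀)))
    (parabola-above (1 , 0) j₀) (≤-by-eval ∷ ≤-by-eval ∷ ≤-by-eval ∷ [])
  crossing-⊈ _  (UL×VAB j) = not-inside (UL j) VAB (-11 , 1) 24 1st <-by-eval (≤-by-eval ∷ ≤-by-eval ∷ ≤-by-eval ∷ [])

  crossing-⊉ : ∀ {h h′} → Crossing h h′ → ¬ ConvSub P (hull h′) (hull h)
  crossing-⊉ UVR×URB    = not-inside URB UVR (1 , 0) -3 3rd <-by-eval (≤-by-eval ∷ ≤-by-eval ∷ ≤-by-eval ∷ [])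
  crossing-⊉ UAB×VAB    = not-inside VAB UAB (0 , -1) 8 1st <-by-eval (≤-by-eval ∷ ≤-by-eval ∷ ≤-by-eval ∷ [])
  crossing-⊉ UAB×URB    = not-inside URB UAB (-1 , 0) 3 2nd <-by-eval (≤-by-eval ∷ ≤-by-eval ∷ ≤-by-eval ∷ [])
  crossing-⊉ RBL×RAL    = not-inside RAL RBL (-1 , -1) 0 2nd <-by-eval
    (≤-by-eval ∷ ≤-by-eval ∷ tabulate⁺ (parabola-below (-1 , -1)))
  crossing-⊉ RBL×URB    = not-inside URB RBL (0 , -1) 0 1st <-by-eval
    (≤-by-eval ∷ ≤-by-eval ∷ tabulate⁺ (parabola-below (0 , -1)))
  crossing-⊉ (UL×VAB j) = not-inside VAB (UL j) (0 , -1) 8 1st <-by-eval (≤-by-eval ∷ parabola-below (0 , -1) j ∷ [])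

  relate : ∀ h h′ → h ≢ h′ → Touching P (hull h) (hull h′) ⊎ Crossing h h′ ⊎ Crossing h′ h
  relate UVR    UVR    h≢h′ = ⊥-elim (h≢h′ refl)
  relate UVR    UAB    _     = inj₁ (Touching-sym UAB-UVR)
  relate UVR    VAB    _     = inj₁ (Touching-sym VAB-UVR)
  relate UVR    URB    _     = inj₂ (inj₁ UVR×URB)
  relate UVR    RBL    _     = inj₁ (Touching-sym RBL-UVR)
  relate UVR    RAL    _     = inj₁ (Touching-sym RAL-UVR)
  relate UVR    (UL j) _     = inj₁ (Touching-sym (UL-UVR j))
  relate UAB    UVR    _     = inj₁ UAB-UVR
  relate UAB    UAB    h≢h′ = ⊥-elim (h≢h′ refl)
  relate UAB    VAB    _     = inj₂ (inj₁ UAB×VAB)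
  relate UAB    URB    _     = inj₂ (inj₁ UAB×URB)
  relate UAB    RBL    _     = inj₁ (Touching-sym RBL-UAB)
  relate UAB    RAL    _     = inj₁ (Touching-sym RAL-UAB)
  relate UAB    (UL j) _     = inj₁ (Touching-sym (UL-UAB j))
  relate VAB    UVR    _     = inj₁ VAB-UVR
  relate VAB    UAB    _     = inj₂ (inj₂ UAB×VAB)
  relate VAB    VAB    h≢h′ = ⊥-elim (h≢h′ refl)
  relate VAB    URB    _     = inj₁ (Touching-sym URB-VAB)
  relate VAB    RBL    _     = inj₁ (Touching-sym RBL-VAB)
  relate VAB    RAL    _     = inj₁ (Touching-sym RAL-VAB)
  relate VAB    (UL j) _     = inj₂ (inj₂ (UL×VAB j))
  relate URB    UVR    _     = inj₂ (inj₂ UVR×URB)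
  relate URB    UAB    _     = inj₂ (inj₂ UAB×URB)
  relate URB    VAB    _     = inj₁ URB-VAB
  relate URB    URB    h≢h′ = ⊥-elim (h≢h′ refl)
  relate URB    RBL    _     = inj₂ (inj₂ RBL×URB)
  relate URB    RAL    _     = inj₁ (Touching-sym RAL-URB)
  relate URB    (UL j) _     = inj₁ (Touching-sym (UL-URB j))
  relate RBL    UVR    _     = inj₁ RBL-UVR
  relate RBL    UAB    _     = inj₁ RBL-UAB
  relate RBL    VAB    _     = inj₁ RBL-VAB
  relate RBL    URB    _     = inj₂ (inj₁ RBL×URB)
  relate RBL    RBL    h≢h′ = ⊥-elim (h≢h′ refl)
  relate RBL    RAL    _     = inj₂ (inj₁ RBL×RAL)
  relate RBL    (UL j) _     = inj₁ (RBL-UL j)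
  relate RAL    UVR    _     = inj₁ RAL-UVR
  relate RAL    UAB    _     = inj₁ RAL-UAB
  relate RAL    VAB    _     = inj₁ RAL-VAB
  relate RAL    URB    _     = inj₁ RAL-URB
  relate RAL    RBL    _     = inj₂ (inj₂ RBL×RAL)
  relate RAL    RAL    h≢h′ = ⊥-elim (h≢h′ refl)
  relate RAL    (UL j) _     = inj₁ (RAL-UL j)
  relate (UL j) UVR    _     = inj₁ (UL-UVR j)
  relate (UL j) UAB    _     = inj₁ (UL-UAB j)
  relate (UL j) VAB    _     = inj₂ (inj₁ (UL×VAB j))
  relate (UL j) URB    _     = inj₁ (UL-URB j)
  relate (UL j) RBL    _     = inj₁ (Touching-sym (RBL-UL j))
  relate (UL j) RAL    _     = inj₁ (Touching-sym (RAL-UL j))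
  relate (UL j) (UL k) h≢h′ = inj₁ (UL-UL k j (λ { refl → h≢h′ refl }))

  same-side⇒touching : ∀ h h′ → h ≢ h′ → side h ≡ side h′ → Touching P (hull h) (hull h′)
  same-side⇒touching h h′ h≢h′ same with relate h h′ h≢h′
  ... | inj₁ touch        = touch
  ... | inj₂ (inj₁ cross) = ⊥-elim (crossing-sides cross same)
  ... | inj₂ (inj₂ cross) = ⊥-elim (crossing-sides cross (sym same))

  two-vertices : ∀ h → ∃₂ λ i i′ → i ∈ hull h × i′ ∈ hull h × i ≢ i′
  two-vertices UVR    = U , V   , ∈hull UVR 1st , ∈hull UVR 2nd , λ ()
  two-vertices UAB    = U , A   , ∈hull UAB 1st , ∈hull UAB 2nd , λ ()
  two-vertices VAB    = V , A   , ∈hull VAB 1st , ∈hull VAB 2nd , λ ()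
  two-vertices URB    = U , R   , ∈hull URB 1st , ∈hull URB 2nd , λ ()
  two-vertices RBL    = R , B   , ∈hull RBL 1st , ∈hull RBL 2nd , λ ()
  two-vertices RAL    = R , A   , ∈hull RAL 1st , ∈hull RAL 2nd , λ ()
  two-vertices (UL j) = U , L j , ∈hull (UL j) 1st , ∈hull (UL j) 2nd , λ ()

  hulls-not-nested : Fin m → ∀ h h′ → h ≢ h′ → ¬ ConvSub P (hull h) (hull h′)
  hulls-not-nested j₀ h h′ h≢h′ with relate h h′ h≢h′ | two-vertices h
  ... | inj₁ touch        | i , i′ , i∈h , i′∈h , i≢i′ = Touching⇒⊈ (proj₁ P-generalPosition) touch i∈h i′∈h i≢i′
  ... | inj₂ (inj₁ cross) | _ = crossing-⊈ j₀ cross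
  ... | inj₂ (inj₂ cross) | _ = crossing-⊉ cross

  hulls-meet : ∀ h h′ → h ≢ h′ → ∃ λ q → InConv P (hull h) q × InConv P (hull h′) q
  hulls-meet h h′ h≢h′ with relate h h′ h≢h′
  ... | inj₁ touch        = Touching⇒meet touch
  ... | inj₂ (inj₁ cross) = crossing-meet cross
  ... | inj₂ (inj₂ cross) with crossing-meet cross
  ...   | q , q∈h′ , q∈h  = q , q∈h , q∈h′

  triple-meets-in-P : ∀ a b c → a ≢ b → b ≢ c → a ≢ c → ∀ q →
                      InConv P (hull a) q → InConv P (hull b) q → InConv P (hull c) q → ∃ λ i → P i ≡ q
  triple-meets-in-P a b c a≢b b≢c a≢c q q∈a q∈b q∈c with two-agree (side a) (side b) (side c)
  ... | inj₁ ab        = Touching⇒vertex (same-side⇒touching a b a≢b ab) q∈a q∈b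
  ... | inj₂ (inj₁ bc) = Touching⇒vertex (same-side⇒touching b c b≢c bc) q∈b q∈c
  ... | inj₂ (inj₂ ac) = Touching⇒vertex (same-side⇒touching a c a≢c ac) q∈a q∈c

  thrackle : Fin m → IsConvexHullThrackle P hull
  thrackle j₀ = (λ h h′ h≢h′ → hulls-not-nested j₀ h h′ h≢h′ ∘ proj₁) , hulls-not-nested j₀ , hulls-meet , triple-meets-in-P

theorem1 : (n : ℕ) → 6 ℕ.≤ n →
    Σ (Fin n → Point) λ p → Σ (Fin (suc n) → Subset n) λ S →
      GeneralPosition p × IsConvexHullThrackle p S
theorem1 _ (s≤s (s≤s (s≤s (s≤s (s≤s (s≤s (z≤n {k}))))))) = P , hull , P-generalPosition , thrackle zero
  where open Construction (suc k)
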